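{- Let $\mathcal{Q}$ be a node query expressed by a key-invariant LocalSum GNN whose combination functions are ReLU feedforward networks. Then $\mathcal{Q}$ is definable in order-invariant first-order logic with counting, i.e. $\mathcal{Q}\in\mathrm{OrdInvFO{+}C}$.
   Context: Fix a finite set $\Pi=\{p_1,\dots,p_n\}$ of propositions. A graph is $G=(V,E,\mathrm{lab})$ with $V$ finite, $E\subseteq V\times V$ irreflexive and symmetric, $\mathrm{lab}:V\to\{0,1\}^n$; a pointed graph $G^u$ has distinguished node $u$; a node query is an isomorphism-closed class of pointed graphs. A keyed extension adds an injective $\mathrm{key}:V\to\mathbb{R}$. A GNN is a sequence of layers $(\mathrm{agg}_i,\mathrm{com}_i)_{i=1}^\ell$, $\mathrm{com}_i:\mathbb{R}^{2D_i}\to\mathbb{R}^{D_{i+1}}$, $D_1=n+1$, $D_{\ell+1}=1$; on a keyed graph the initial embedding is $\mathrm{lab}(v)\oplus(\mathrm{key}(v))$, each layer computes $\mathrm{emb}'(u)=\mathrm{com}_i(\mathrm{emb}(u),\mathrm{agg}_i(\{\!\{\mathrm{emb}(v)\mid(u,v)\in E\}\!\}))$, output is the final value at the distinguished node. LocalSum: each $\mathrm{agg}_i$ is coordinate-wise sum. A ReLU feedforward network is a composition of affine maps with rational coefficients and coordinate-wise $\mathrm{ReLU}(x)=\max(x,0)$. Accept iff output $>0$; key-invariant if for every pointed graph all or none of its keyed extensions are accepted; then it expresses the query of pointed graphs whose keyed extensions are accepted. First-order logic with counting (FO+C) over a structure (here a graph, possibly with a linear order $<$ and unary predicates $p\in\Pi$)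 is two-sorted: node variables range over $V$, number variables over $\mathbb{N}$. Terms: number variables, constants $0,1,\mathrm{ord}$ (interpreted as $|V|$), sums and products of terms, and counting terms $\#(x_1,\dots,x_k,y_1<\theta_1,\dots,y_\ell<\theta_\ell).\psi$, whose value is the number of tuples $(v_1,\dots,v_k,i_1,\dots,i_\ell)\in V^k\times\mathbb{N}^\ell$ with each $i_j$ less than the value of $\theta_j$ such that $\psi$ holds. Formulas: first-order formulas over the graph vocabulary using node variables, plus atomic formulas $\theta\le\eta$ between terms. A formula $\phi(x)$ with one free node variable and no free number variables over vocabulary $\{E,<\}\cup\Pi$ is order-invariant if for every pointed graph $G^u$ and all linear orders $<,<'$ on $V(G)$, $(G,<)\models\phi(u)$ iff $(G,<')\models\phi(u)$; it then defines a node query. $\mathrm{OrdInvFO{+}C}$ is the class of node queries so defined. -}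

module Defs where

open import Level using (0ℓ) renaming (suc to lsuc)
open import Data.Bool using (Bool; true; false; if_then_else_; _∧_; _∨_; not)
open import Data.Nat as ℕ using (ℕ; zero; suc; _≤ᵇ_)
open import Data.Fin as Fin using (Fin; _≟_)
open import Data.List using (List; allFin)
open import Data.Bool.ListAction using (any; all)
open import Data.Nat.ListAction using (sum)
open import Data.Vec as Vec using (Vec; []; _∷_)
open import Data.Vec.Functional as VF using (Vector)
open import Data.Rational as ℚ using (ℚ; 0ℚ; 1ℚ)
open import Data.Product using (Σ; _×_; _,_)
open import Data.Sum using (_⊎_)
open import Relation.Nullary using (¬_; does)
open import Relation.Binary.PropositionalEquality using (_≡_)
open import Function.Bundles using (_⇔_; _↔_; Inverse)
open import Function.Definitions using (Injective)

record Graph (np : ℕ) : Set where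
  field
    N      : ℕ
    adj    : Fin N → Fin N → Bool
    irrefl : ∀ v → adj v v ≡ false
    sym    : ∀ v w → adj v w ≡ adj w v
    lab    : Fin N → Vec Bool np
open Graph public

record PointedIso {np : ℕ} (G : Graph np) (u : Fin (N G))
                  (H : Graph np) (w : Fin (N H)) : Set where
  field
    bij      : Fin (N G) ↔ Fin (N H)
  open Inverse bij public using (to)
  field
    adj-pres : ∀ v v' → adj H (to v) (to v') ≡ adj G v v'
    lab-pres : ∀ v → lab H (to v) ≡ lab G v
    pt-pres  : to u ≡ w

NodeQuery : ℕ → Set₁
NodeQuery np = (G : Graph np) → Fin (N G) → Set

IsoClosed : {np : ℕ} → NodeQuery np → Set
IsoClosed {np} Q = ∀ (G H : Graph np) (u : Fin (N G)) (w : Fin (N H)) →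
  PointedIso G u H w → Q G u → Q H w

data FFN : ℕ → ℕ → Set where
  idN  : ∀ {m} → FFN m m
  -- first apply the affine map x ↦ W x + b (W has k rows of length m), then the rest
  aff  : ∀ {m k l} → Vec (Vec ℚ m) k → Vec ℚ k → FFN k l → FFN m l
  relu : ∀ {m l} → FFN m l → FFN m l

ReLU : ℚ → ℚ
ReLU x = x ℚ.⊔ 0ℚ

dot : ∀ {m} → Vec ℚ m → Vec ℚ m → ℚ
dot xs ys = Vec.foldr _ ℚ._+_ 0ℚ (Vec.zipWith ℚ._*_ xs ys)

evalFFN : ∀ {m l} → FFN m l → Vec ℚ m → Vec ℚ l
evalFFN idN        x = x
evalFFN (aff W b f) x = evalFFN f (Vec.zipWith ℚ._+_ (Vec.map (λ row → dot row x) W) b)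
evalFFN (relu f)   x = evalFFN f (Vec.map ReLU x)

-- LocalSum GNNs whose combination functions are ReLU FFNs.
-- GNN d : remaining layers, current embedding dimension d, final dimension 1.

data GNN : ℕ → Set where
  done  : GNN 1
  layer : ∀ {d d'} → FFN (d ℕ.+ d) d' → GNN d' → GNN d

bit : Bool → ℚ
bit true  = 1ℚ
bit false = 0ℚ

vsum : ∀ {d} → List (Vec ℚ d) → Vec ℚ d
vsum = Data.List.foldr (Vec.zipWith ℚ._+_) (Vec.replicate _ 0ℚ)

aggSum : ∀ {np d} (G : Graph np) → (Fin (N G) → Vec ℚ d) → Fin (N G) → Vec ℚ d
aggSum G emb u = vsum (Data.List.map emb (Data.List.filter (λ v → Relation.Nullary.Decidable.Core.T? (adj G u v)) (allFin (N G))))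
  where import Relation.Nullary.Decidable.Core

runGNN : ∀ {np d} (G : Graph np) → GNN d → (Fin (N G) → Vec ℚ d) → Fin (N G) → Vec ℚ 1
runGNN G done        emb = emb
runGNN G (layer c g) emb = runGNN G g (λ u → evalFFN c (emb u Vec.++ aggSum G emb u))

Key : ∀ {np} → Graph np → Set
Key G = Σ (Fin (N G) → ℚ) (λ key → Injective _≡_ _≡_ key)

initEmb' : ∀ {np} (G : Graph np) → (Fin (N G) → ℚ) → Fin (N G) → Vec ℚ (np ℕ.+ 1)
initEmb' G key v = Vec.map bit (lab G v) Vec.++ (key v ∷ [])

Accepts : ∀ {np} → GNN (np ℕ.+ 1) → (G : Graph np) → Fin (N G) → Key G → Set
Accepts 𝒜 G u (key , _) = 0ℚ ℚ.< Vec.head (runGNN G 𝒜 (initEmb' G key) u)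

KeyInvariant : ∀ {np} → GNN (np ℕ.+ 1) → Set
KeyInvariant {np} 𝒜 = ∀ (G : Graph np) (u : Fin (N G)) (k k' : Key G) →
  Accepts 𝒜 G u k ⇔ Accepts 𝒜 G u k'

Expresses : ∀ {np} → GNN (np ℕ.+ 1) → NodeQuery np → Set
Expresses {np} 𝒜 Q = ∀ (G : Graph np) (u : Fin (N G)) →
  Q G u ⇔ (∀ (k : Key G) → Accepts 𝒜 G u k)

-- FO+C over vocabulary {E, <} ∪ Π.  Formula a b : a free node variables,
-- b free number variables (de Bruijn, Fin-indexed).

mutual
  data Term (np a b : ℕ) : Set where
    nvar  : Fin b → Term np a b
    zeroT : Term np a b
    oneT  : Term np a b
    ord   : Term np a b
    _⊕_   : Term np a b → Term np a b → Term np a b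
    _⊗_   : Term np a b → Term np a b → Term np a b
    -- #(x_1..x_k, y_1 < θ_1, …, y_l < θ_l). ψ
    -- new node variables are indices 0..k-1 of Fin (k + a),
    -- new number variables are indices 0..l-1 of Fin (l + b)
    count : (k l : ℕ) → (Fin l → Term np a b) → Formula np (k ℕ.+ a) (l ℕ.+ b) → Term np a b

  data Formula (np a b : ℕ) : Set where
    ⊤F ⊥F  : Formula np a b
    edge   : Fin a → Fin a → Formula np a b
    less   : Fin a → Fin a → Formula np a b
    eqN    : Fin a → Fin a → Formula np a b
    prop   : Fin np → Fin a → Formula np a b
    leqT   : Term np a b → Term np a b → Formula np a b
    ¬F     : Formula np a b → Formula np a b
    _∧F_ _∨F_ : Formula np a b → Formula np a b → Formula np a b
    ∃F ∀F  : Formula np (suc a) b → Formula np a b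

record LinOrder {np : ℕ} (G : Graph np) : Set where
  field
    lt      : Fin (N G) → Fin (N G) → Bool
    irrefl  : ∀ v → lt v v ≡ false
    trans   : ∀ u v w → lt u v ≡ true → lt v w ≡ true → lt u w ≡ true
    total   : ∀ v w → ¬ (v ≡ w) → lt v w ≡ true ⊎ lt w v ≡ true
open LinOrder public

sumBelow : ℕ → (ℕ → ℕ) → ℕ
sumBelow zero    f = 0
sumBelow (suc n) f = sumBelow n f ℕ.+ f n

sumFin : ∀ n → (Fin n → ℕ) → ℕ
sumFin n f = sum (Data.List.map f (allFin n))

sumTuples : (n k : ℕ) → (Vector (Fin n) k → ℕ) → ℕ
sumTuples n zero    f = f VF.[]
sumTuples n (suc k) f = sumFin n (λ v → sumTuples n k (λ vs → f (v VF.∷ vs)))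

sumBounded : (l : ℕ) → Vector ℕ l → (Vector ℕ l → ℕ) → ℕ
sumBounded zero    bs f = f VF.[]
sumBounded (suc l) bs f =
  sumBelow (VF.head bs) (λ i → sumBounded l (VF.tail bs) (λ is → f (i VF.∷ is)))

fromBool : Bool → ℕ
fromBool true  = 1
fromBool false = 0

module Sem {np : ℕ} (G : Graph np) (O : LinOrder G) where
  V = Fin (N G)

  mutual
    evalT : ∀ {a b} → Term np a b → Vector V a → Vector ℕ b → ℕ
    evalT (nvar i)  ρ σ = σ i
    evalT zeroT     ρ σ = 0
    evalT oneT      ρ σ = 1
    evalT ord       ρ σ = N G
    evalT (s ⊕ t)   ρ σ = evalT s ρ σ ℕ.+ evalT t ρ σ
    evalT (s ⊗ t)   ρ σ = evalT s ρ σ ℕ.* evalT t ρ σ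
    evalT (count k l θ ψ) ρ σ =
      sumTuples (N G) k (λ vs →
        sumBounded l (λ j → evalT (θ j) ρ σ) (λ is →
          fromBool (evalF ψ (vs VF.++ ρ) (is VF.++ σ))))

    evalF : ∀ {a b} → Formula np a b → Vector V a → Vector ℕ b → Bool
    evalF ⊤F          ρ σ = true
    evalF ⊥F          ρ σ = false
    evalF (edge x y)  ρ σ = adj G (ρ x) (ρ y)
    evalF (less x y)  ρ σ = lt O (ρ x) (ρ y)
    evalF (eqN x y)   ρ σ = does (ρ x ≟ ρ y)
    evalF (prop p x)  ρ σ = Vec.lookup (lab G (ρ x)) p
    evalF (leqT s t)  ρ σ = evalT s ρ σ ≤ᵇ evalT t ρ σ
    evalF (¬F φ)      ρ σ = not (evalF φ ρ σ)
    evalF (φ ∧F ψ)    ρ σ = evalF φ ρ σ ∧ evalF ψ ρ σ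
    evalF (φ ∨F ψ)    ρ σ = evalF φ ρ σ ∨ evalF ψ ρ σ
    evalF (∃F φ)      ρ σ = any (λ v → evalF φ (v VF.∷ ρ) σ) (allFin (N G))
    evalF (∀F φ)      ρ σ = all (λ v → evalF φ (v VF.∷ ρ) σ) (allFin (N G))

Sat : ∀ {np} (G : Graph np) → LinOrder G → Formula np 1 0 → Fin (N G) → Bool
Sat G O φ u = Sem.evalF G O φ (u VF.∷ VF.[]) VF.[]

OrderInvariant : ∀ {np} → Formula np 1 0 → Set
OrderInvariant {np} φ = ∀ (G : Graph np) (O O' : LinOrder G) (u : Fin (N G)) →
  Sat G O φ u ≡ Sat G O' φ u

DefinesQuery : ∀ {np} → Formula np 1 0 → NodeQuery np → Set
DefinesQuery {np} φ Q = ∀ (G : Graph np) (O : LinOrder G) (u : Fin (N G)) →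
  Q G u ⇔ (Sat G O φ u ≡ true)

InOrdInvFOC : ∀ {np} → NodeQuery np → Set
InOrdInvFOC {np} Q = Σ (Formula np 1 0) (λ φ → OrderInvariant φ × DefinesQuery φ Q)

-- Fix a linear order and key every node by its rank in it. Then every coordinate
-- of every embedding the GNN computes has the form (P(v) - M(v)) / (1 + D), with D
-- a constant and P, M natural-number expressions built from constants, |V|, the
-- rank, label bits, +, *, truncated subtraction and sums over neighbours: rational
-- weights only change the constants, sums of neighbour embeddings become sums
-- over neighbours, and ReLU turns P - M into P ∸ M. Such expressions are FO+C
-- counting terms, so acceptance (M < P at the output) is FO+C-definable in the
-- presence of the order. Key invariance makes the formula order-invariant, and
-- the GNN accepts under the rank key exactly when it accepts under every key.
module Submission where

open import Data.Bool using (Bool; true; false; _∧_; if_then_else_)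
open import Data.Bool.Properties using (T-≡)
open import Data.Empty using (⊥-elim)
open import Data.Fin as Fin using (Fin)
open import Data.Integer as ℤ using (+_; -[1+_])
import Data.Integer.Properties as ℤ
open import Data.List using (List; []; _∷_; map; filter; length; allFin)
open import Data.List.Membership.Propositional using (_∈_)
open import Data.List.Membership.Propositional.Properties using (∈-allFin)
open import Data.List.Properties using (length-tabulate; length-filter; map-cong)
open import Data.List.Relation.Unary.Any using (here; there)
open import Data.Nat as ℕ using (ℕ; zero; suc; _∸_; _⊓_; _≤ᵇ_; z≤n)
import Data.Nat.Properties as ℕ
open import Data.Nat.ListAction using (sum)
open import Data.Product using (_,_)
open import Data.Rational as ℚ using (ℚ; mkℚ; 0ℚ; _+_; _*_; _-_; -_; _⊔_; _<_; _≤_; _/_; *<*)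
open import Data.Rational.Literals using (fromℤ)
import Data.Rational.Properties as ℚ
open import Data.Rational.Solver using (module +-*-Solver)
import Data.Rational.Unnormalised as ℚᵘ
import Data.Rational.Unnormalised.Properties as ℚᵘ
open import Data.Sum using (inj₁; inj₂)
open import Data.Vec as Vec using (Vec; []; _∷_)
open import Data.Vec.Functional as VF using (Vector)
open import Data.Vec.Properties using (tabulate∘lookup; lookup-map)
open import Data.Vec.Relation.Binary.Pointwise.Inductive using (Pointwise; []; _∷_; ++⁺; map⁺; tabulate⁺)
open import Function using (_∘_; _$_)
open import Function.Bundles using (_⇔_; mk⇔; Equivalence)
import Function.Properties.Equivalence as ⇔
open import Relation.Binary.PropositionalEquality
open import Relation.Nullary using (yes; no)
open import Relation.Nullary.Decidable.Core using (T?)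
open import Relation.Nullary.Reflects using (ofʸ; ofⁿ)

open import Defs hiding (sym; trans)

open ≡-Reasoning
open +-*-Solver using (solve; _:+_; _:-_; _:*_; _:=_)

ι : ℕ → ℚ
ι n = fromℤ (+ n)

fromℤ-+ : ∀ i j → fromℤ (i ℤ.+ j) ≡ fromℤ i + fromℤ j
fromℤ-+ i j = sym (trans (cong₂ (λ a b → (a ℤ.+ b) / 1) (ℤ.*-identityʳ i) (ℤ.*-identityʳ j))
                         (ℚ.↥p/↧p≡p (fromℤ (i ℤ.+ j))))

fromℤ-* : ∀ i j → fromℤ (i ℤ.* j) ≡ fromℤ i * fromℤ j
fromℤ-* i j = sym (ℚ.↥p/↧p≡p (fromℤ (i ℤ.* j)))

ι-+ : ∀ m n → ι (m ℕ.+ n) ≡ ι m + ι n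
ι-+ m n = trans (cong fromℤ (ℤ.pos-+ m n)) (fromℤ-+ (+ m) (+ n))

ι-* : ∀ m n → ι (m ℕ.* n) ≡ ι m * ι n
ι-* m n = trans (cong fromℤ (ℤ.pos-* m n)) (fromℤ-* (+ m) (+ n))

ι-injective : ∀ {m n} → ι m ≡ ι n → m ≡ n
ι-injective = ℤ.+-injective ∘ cong ℚ.↥_

ι-<⇔ : ∀ {m n} → ι m < ι n ⇔ m ℕ.< n
ι-<⇔ {m} {n} = mk⇔
  (λ { (*<* lt) → ℤ.drop‿+<+ (subst₂ ℤ._<_ (ℤ.*-identityʳ (+ m)) (ℤ.*-identityʳ (+ n)) lt) })
  (λ lt → *<* (subst₂ ℤ._<_ (sym (ℤ.*-identityʳ (+ m))) (sym (ℤ.*-identityʳ (+ n))) (ℤ.+<+ lt)))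

ι-mono-≤ : ∀ {m n} → m ℕ.≤ n → ι m ≤ ι n
ι-mono-≤ {m} {n} le = ℚ.*≤* (subst₂ ℤ._≤_ (sym (ℤ.*-identityʳ (+ m))) (sym (ℤ.*-identityʳ (+ n))) (ℤ.+≤+ le))

ι-nonNeg : ∀ n → 0ℚ ≤ ι n
ι-nonNeg n = ι-mono-≤ z≤n

ι-*+* : ∀ a b c d → ι (a ℕ.* b ℕ.+ c ℕ.* d) ≡ ι a * ι b + ι c * ι d
ι-*+* a b c d = trans (ι-+ (a ℕ.* b) (c ℕ.* d)) (cong₂ _+_ (ι-* a b) (ι-* c d))

ι-∸-≤ : ∀ {m n} → n ℕ.≤ m → ι m - ι n ≡ ι (m ∸ n)
ι-∸-≤ {m} {n} n≤m = begin
  ι m - ι n               ≡⟨ cong (λ k → ι k - ι n) (sym (ℕ.m∸n+n≡m n≤m)) ⟩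
  ι (m ∸ n ℕ.+ n) - ι n   ≡⟨ cong (_- ι n) (ι-+ (m ∸ n) n) ⟩
  (ι (m ∸ n) + ι n) - ι n ≡⟨ solve 2 (λ x y → (x :+ y) :- y := x) refl (ι (m ∸ n)) (ι n) ⟩
  ι (m ∸ n)               ∎

0<q-p⇔p<q : ∀ {p q} → 0ℚ < q - p ⇔ p < q
0<q-p⇔p<q {p} {q} = mk⇔
  (λ 0<q-p → subst₂ _<_ (ℚ.+-identityˡ p) (solve 2 (λ p q → (q :- p) :+ p := q) refl p q)
                        (ℚ.+-mono-<-≤ 0<q-p (ℚ.≤-refl {p})))
  (λ p<q → subst (_< q - p) (ℚ.+-inverseʳ p) (ℚ.+-mono-<-≤ p<q (ℚ.≤-refl { - p})))

p≤q⇒p-q≤0 : ∀ {p q} → p ≤ q → p - q ≤ 0ℚ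
p≤q⇒p-q≤0 {p} {q} p≤q = subst (p - q ≤_) (ℚ.+-inverseʳ q) (ℚ.+-mono-≤ p≤q (ℚ.≤-refl { - q}))

ι-∸ : ∀ m n → ι (m ∸ n) ≡ (ι m - ι n) ⊔ 0ℚ
ι-∸ m n with ℕ.≤-total n m
... | inj₁ n≤m = sym (trans (cong (_⊔ 0ℚ) (ι-∸-≤ n≤m)) (ℚ.p≥q⇒p⊔q≡p (ι-nonNeg (m ∸ n))))
... | inj₂ m≤n = trans (cong ι (ℕ.m≤n⇒m∸n≡0 m≤n)) (sym (ℚ.p≤q⇒p⊔q≡q (p≤q⇒p-q≤0 (ι-mono-≤ m≤n))))

record Encodes (p m d : ℕ) (x : ℚ) : Set where
  constructor encodes
  field cleared : ι (suc d) * x ≡ ι p - ι m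

-- Denominators are stored minus one: suc (d ⊛ e) reduces to suc d * suc e.
_⊛_ : ℕ → ℕ → ℕ
d ⊛ e = e ℕ.+ d ℕ.* suc e

encodes-0 : ∀ d → Encodes 0 0 d 0ℚ
encodes-0 d = encodes (ℚ.*-zeroʳ (ι (suc d)))

encodes-ι : ∀ n → Encodes n 0 0 (ι n)
encodes-ι n = encodes (trans (ℚ.*-identityˡ (ι n)) (sym (ℚ.+-identityʳ (ι n))))

numerator⁺ numerator⁻ : ℚ → ℕ
numerator⁺ (mkℚ (+ a)    _ _) = a
numerator⁺ (mkℚ -[1+ _ ] _ _) = 0
numerator⁻ (mkℚ (+ _)    _ _) = 0
numerator⁻ (mkℚ -[1+ k ] _ _) = suc k

encodes-bit : ∀ c → Encodes (fromBool c) 0 0 (bit c)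
encodes-bit true  = encodes-ι 1
encodes-bit false = encodes-ι 0

encodes-ℚ : ∀ w → Encodes (numerator⁺ w) (numerator⁻ w) (ℚ.denominator-1 w) w
encodes-ℚ w = encodes (trans (denominator*w≡numerator w) (numerator-split w))
  where
  denominator*w≡numerator : ∀ w → ι (suc (ℚ.denominator-1 w)) * w ≡ fromℤ (ℚ.↥ w)
  denominator*w≡numerator w@(mkℚ n d _) = ℚ.toℚᵘ-injective (ℚᵘ.≃-trans (ℚ.toℚᵘ-homo-* (ι (suc d)) w)
    (ℚᵘ.*≡* (trans (ℤ.*-identityʳ _) (trans (ℤ.*-comm (+ suc d) n)
      (cong (λ k → n ℤ.* + suc k) (sym (ℕ.+-identityʳ d)))))))
  numerator-split : ∀ w → fromℤ (ℚ.↥ w) ≡ ι (numerator⁺ w) - ι (numerator⁻ w)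
  numerator-split (mkℚ (+ a)    _ _) = sym (ℚ.+-identityʳ (ι a))
  numerator-split (mkℚ -[1+ k ] _ _) = sym (ℚ.+-identityˡ (- ι (suc k)))

encodes-+ : ∀ {p m d x p′ m′ d′ y} → Encodes p m d x → Encodes p′ m′ d′ y →
  Encodes (p ℕ.* suc d′ ℕ.+ p′ ℕ.* suc d) (m ℕ.* suc d′ ℕ.+ m′ ℕ.* suc d) (d ⊛ d′) (x + y)
encodes-+ {p} {m} {d} {x} {p′} {m′} {d′} {y} (encodes enc) (encodes enc′) = encodes $ begin
  ι (suc d ℕ.* suc d′) * (x + y)   ≡⟨ cong (_* (x + y)) (ι-* (suc d) (suc d′)) ⟩
  (δ * δ′) * (x + y)               ≡⟨ solve 4 (λ δ δ′ x y → (δ :* δ′) :* (x :+ y) := (δ :* x) :* δ′ :+ (δ′ :* y) :* δ) refl δ δ′ x y ⟩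
  (δ * x) * δ′ + (δ′ * y) * δ      ≡⟨ cong₂ (λ s t → s * δ′ + t * δ) enc enc′ ⟩
  (ι p - ι m) * δ′ + (ι p′ - ι m′) * δ
    ≡⟨ solve 6 (λ p m p′ m′ δ δ′ → (p :- m) :* δ′ :+ (p′ :- m′) :* δ := (p :* δ′ :+ p′ :* δ) :- (m :* δ′ :+ m′ :* δ)) refl (ι p) (ι m) (ι p′) (ι m′) δ δ′ ⟩
  (ι p * δ′ + ι p′ * δ) - (ι m * δ′ + ι m′ * δ)
    ≡⟨ sym (cong₂ _-_ (ι-*+* p (suc d′) p′ (suc d)) (ι-*+* m (suc d′) m′ (suc d))) ⟩
  ι (p ℕ.* suc d′ ℕ.+ p′ ℕ.* suc d) - ι (m ℕ.* suc d′ ℕ.+ m′ ℕ.* suc d) ∎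
  where δ = ι (suc d); δ′ = ι (suc d′)

encodes-+-sameDen : ∀ {p m d x p′ m′ y} → Encodes p m d x → Encodes p′ m′ d y →
  Encodes (p ℕ.+ p′) (m ℕ.+ m′) d (x + y)
encodes-+-sameDen {p} {m} {d} {x} {p′} {m′} {y} (encodes enc) (encodes enc′) = encodes $ begin
  δ * (x + y)                       ≡⟨ ℚ.*-distribˡ-+ δ x y ⟩
  δ * x + δ * y                     ≡⟨ cong₂ _+_ enc enc′ ⟩
  (ι p - ι m) + (ι p′ - ι m′)       ≡⟨ solve 4 (λ p m p′ m′ → (p :- m) :+ (p′ :- m′) := (p :+ p′) :- (m :+ m′)) refl (ι p) (ι m) (ι p′) (ι m′) ⟩
  (ι p + ι p′) - (ι m + ι m′)       ≡⟨ sym (cong₂ _-_ (ι-+ p p′) (ι-+ m m′)) ⟩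
  ι (p ℕ.+ p′) - ι (m ℕ.+ m′)       ∎
  where δ = ι (suc d)

encodes-* : ∀ {a b e w p m d x} → Encodes a b e w → Encodes p m d x →
  Encodes (a ℕ.* p ℕ.+ b ℕ.* m) (a ℕ.* m ℕ.+ b ℕ.* p) (e ⊛ d) (w * x)
encodes-* {a} {b} {e} {w} {p} {m} {d} {x} (encodes encw) (encodes encx) = encodes $ begin
  ι (suc e ℕ.* suc d) * (w * x)     ≡⟨ cong (_* (w * x)) (ι-* (suc e) (suc d)) ⟩
  (ε * δ) * (w * x)                 ≡⟨ solve 4 (λ ε δ w x → (ε :* δ) :* (w :* x) := (ε :* w) :* (δ :* x)) refl ε δ w x ⟩
  (ε * w) * (δ * x)                 ≡⟨ cong₂ _*_ encw encx ⟩
  (ι a - ι b) * (ι p - ι m)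
    ≡⟨ solve 4 (λ a b p m → (a :- b) :* (p :- m) := (a :* p :+ b :* m) :- (a :* m :+ b :* p)) refl (ι a) (ι b) (ι p) (ι m) ⟩
  (ι a * ι p + ι b * ι m) - (ι a * ι m + ι b * ι p)
    ≡⟨ sym (cong₂ _-_ (ι-*+* a p b m) (ι-*+* a m b p)) ⟩
  ι (a ℕ.* p ℕ.+ b ℕ.* m) - ι (a ℕ.* m ℕ.+ b ℕ.* p) ∎
  where ε = ι (suc e); δ = ι (suc d)

encodes-ReLU : ∀ {p m d x} → Encodes p m d x → Encodes (p ∸ m) 0 d (ReLU x)
encodes-ReLU {p} {m} {d} {x} (encodes enc) = encodes $ begin
  δ * (x ⊔ 0ℚ)            ≡⟨ ℚ.*-distribˡ-⊔-nonNeg δ x 0ℚ ⟩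
  (δ * x) ⊔ (δ * 0ℚ)      ≡⟨ cong₂ _⊔_ enc (ℚ.*-zeroʳ δ) ⟩
  (ι p - ι m) ⊔ 0ℚ        ≡⟨ sym (ι-∸ p m) ⟩
  ι (p ∸ m)               ≡⟨ sym (ℚ.+-identityʳ (ι (p ∸ m))) ⟩
  ι (p ∸ m) - ι 0         ∎
  where δ = ι (suc d)

encodes-positive⇔ : ∀ {p m d x} → Encodes p m d x → 0ℚ < x ⇔ m ℕ.< p
encodes-positive⇔ {p} {m} {d} {x} (encodes enc) =
  ⇔.trans scale (⇔.trans (subst (λ z → 0ℚ < z ⇔ _) (sym enc) 0<q-p⇔p<q) ι-<⇔)
  where
  δ = ι (suc d)
  scale : 0ℚ < x ⇔ 0ℚ < δ * x
  scale = mk⇔ (λ 0<x → subst (_< δ * x) (ℚ.*-zeroʳ δ) (ℚ.*-monoʳ-<-pos δ 0<x))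
              (λ 0<δx → ℚ.*-cancelˡ-<-nonNeg δ (subst (_< δ * x) (sym (ℚ.*-zeroʳ δ)) 0<δx))

≤ᵇ≡true⇔≤ : ∀ m n → ((m ≤ᵇ n) ≡ true) ⇔ m ℕ.≤ n
≤ᵇ≡true⇔≤ m n = ⇔.trans (⇔.sym T-≡) (mk⇔ (ℕ.≤ᵇ⇒≤ m n) ℕ.≤⇒≤ᵇ)

sumBelow-cong : ∀ n {f g : ℕ → ℕ} → (∀ i → f i ≡ g i) → sumBelow n f ≡ sumBelow n g
sumBelow-cong zero    f≗g = refl
sumBelow-cong (suc n) f≗g = cong₂ ℕ._+_ (sumBelow-cong n f≗g) (f≗g n)

sumBelow-∧ : ∀ n c (f : ℕ → Bool) →
  sumBelow n (λ i → fromBool (c ∧ f i)) ≡ (if c then sumBelow n (fromBool ∘ f) else 0)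
sumBelow-∧ n       true  f = refl
sumBelow-∧ zero    false f = refl
sumBelow-∧ (suc n) false f = cong (ℕ._+ 0) (sumBelow-∧ n false f)

count-≤ : ∀ n m → sumBelow n (λ i → fromBool (m ≤ᵇ i)) ≡ n ∸ m
count-≤ zero    m = sym (ℕ.0∸n≡0 m)
count-≤ (suc n) m with m ≤ᵇ n | ℕ.≤ᵇ-reflects-≤ m n
... | true  | ofʸ m≤n = begin
  sumBelow n _ ℕ.+ 1  ≡⟨ cong (ℕ._+ 1) (count-≤ n m) ⟩
  n ∸ m ℕ.+ 1         ≡⟨ sym (ℕ.+-∸-comm 1 m≤n) ⟩
  n ℕ.+ 1 ∸ m         ≡⟨ cong (_∸ m) (ℕ.+-comm n 1) ⟩
  suc n ∸ m           ∎
... | false | ofⁿ m≰n = begin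
  sumBelow n _ ℕ.+ 0  ≡⟨ ℕ.+-identityʳ _ ⟩
  sumBelow n _        ≡⟨ count-≤ n m ⟩
  n ∸ m               ≡⟨ ℕ.m≤n⇒m∸n≡0 (ℕ.<⇒≤ n<m) ⟩
  0                   ≡⟨ sym (ℕ.m≤n⇒m∸n≡0 n<m) ⟩
  suc n ∸ m           ∎
  where n<m = ℕ.≰⇒> m≰n

count-< : ∀ n k → sumBelow n (λ i → fromBool (suc i ≤ᵇ k)) ≡ n ⊓ k
count-< zero    k = refl
count-< (suc n) k with suc n ≤ᵇ k | ℕ.≤ᵇ-reflects-≤ (suc n) k
... | true  | ofʸ n<k = begin
  sumBelow n _ ℕ.+ 1  ≡⟨ cong (ℕ._+ 1) (count-< n k) ⟩
  n ⊓ k ℕ.+ 1         ≡⟨ cong (ℕ._+ 1) (ℕ.m≤n⇒m⊓n≡m (ℕ.<⇒≤ n<k)) ⟩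
  n ℕ.+ 1             ≡⟨ ℕ.+-comm n 1 ⟩
  suc n               ≡⟨ sym (ℕ.m≤n⇒m⊓n≡m n<k) ⟩
  suc n ⊓ k           ∎
... | false | ofⁿ n≮k = begin
  sumBelow n _ ℕ.+ 0  ≡⟨ ℕ.+-identityʳ _ ⟩
  sumBelow n _        ≡⟨ count-< n k ⟩
  n ⊓ k               ≡⟨ ℕ.m≥n⇒m⊓n≡n k≤n ⟩
  k                   ≡⟨ sym (ℕ.m≥n⇒m⊓n≡n (ℕ.m≤n⇒m≤1+n k≤n)) ⟩
  suc n ⊓ k           ∎
  where k≤n = ℕ.≤-pred (ℕ.≰⇒> n≮k)

sum-map-if : ∀ {A : Set} (p : A → Bool) (f : A → ℕ) xs →
  sum (map (λ y → if p y then f y else 0) xs) ≡ sum (map f (filter (T? ∘ p) xs))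
sum-map-if p f []       = refl
sum-map-if p f (x ∷ xs) with p x
... | true  = cong (f x ℕ.+_) (sum-map-if p f xs)
... | false = sum-map-if p f xs

sum-map-≤-length* : ∀ {A : Set} (f : A → ℕ) {B} xs → (∀ x → f x ℕ.≤ B) → sum (map f xs) ℕ.≤ length xs ℕ.* B
sum-map-≤-length* f []       f≤B = z≤n
sum-map-≤-length* f (x ∷ xs) f≤B = ℕ.+-mono-≤ (f≤B x) (sum-map-≤-length* f xs f≤B)

sum-map-mono : ∀ {A : Set} {f g : A → ℕ} xs → (∀ x → f x ℕ.≤ g x) → sum (map f xs) ℕ.≤ sum (map g xs)
sum-map-mono []       f≤g = z≤n
sum-map-mono (x ∷ xs) f≤g = ℕ.+-mono-≤ (f≤g x) (sum-map-mono xs f≤g)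

sum-map-mono-< : ∀ {A : Set} {f g : A → ℕ} {xs z} → (∀ x → f x ℕ.≤ g x) → z ∈ xs → f z ℕ.< g z →
  sum (map f xs) ℕ.< sum (map g xs)
sum-map-mono-< {xs = x ∷ xs} f≤g (here refl) fz<gz = ℕ.+-mono-<-≤ fz<gz (sum-map-mono xs f≤g)
sum-map-mono-< {xs = x ∷ xs} f≤g (there z∈xs) fz<gz = ℕ.+-mono-≤-< (f≤g x) (sum-map-mono-< f≤g z∈xs fz<gz)

data NatExpr (np : ℕ) : Set where
  const          : ℕ → NatExpr np
  size rank      : NatExpr np
  label          : Fin np → NatExpr np
  _+ᴱ_ _*ᴱ_ _∸ᴱ_ : NatExpr np → NatExpr np → NatExpr np
  neighbourSum   : NatExpr np → NatExpr np

infixl 6 _+ᴱ_ _∸ᴱ_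
infixl 7 _*ᴱ_

numeral : ∀ {np a b} → ℕ → Term np a b
numeral zero    = zeroT
numeral (suc n) = oneT ⊕ numeral n

-- A closed term dominating the expression at every node; needed because the
-- number variables of a counting term must be bounded.
bound : ∀ {np a b} → NatExpr np → Term np a b
bound (const n)        = numeral n
bound size             = ord
bound rank             = ord
bound (label _)        = oneT
bound (e +ᴱ f)         = bound e ⊕ bound f
bound (e *ᴱ f)         = bound e ⊗ bound f
bound (e ∸ᴱ _)         = bound e
bound (neighbourSum e) = ord ⊗ bound e

-- e ∸ f counts the i < e with f ≤ i; the neighbour sum of e counts the pairs
-- (y, i) with y adjacent to x and i < e(y), i ranging below the bound of e.
term : ∀ {np a b} → NatExpr np → Fin a → Term np a b
term (const n)        x = numeral n
term size             x = ord
term rank             x = count 1 0 (λ ()) (less Fin.zero (Fin.suc x))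
term (label p)        x = count 0 0 (λ ()) (prop p x)
term (e +ᴱ f)         x = term e x ⊕ term f x
term (e *ᴱ f)         x = term e x ⊗ term f x
term (e ∸ᴱ f)         x = count 0 1 (λ _ → term e x) (leqT (term f x) (nvar Fin.zero))
term (neighbourSum e) x = count 1 1 (λ _ → bound e)
  (edge (Fin.suc x) Fin.zero ∧F leqT (oneT ⊕ nvar Fin.zero) (term e Fin.zero))

module _ {A B : Set} {R : A → B → Set} where

  Pointwise-head : ∀ {n} {qs : Vec A (suc n)} {xs : Vec B (suc n)} → Pointwise R qs xs → R (Vec.head qs) (Vec.head xs)
  Pointwise-head (r ∷ _) = r

  Pointwise-replicate : ∀ {c} → (∀ q → R q c) → ∀ {n} (qs : Vec A n) → Pointwise R qs (Vec.replicate n c)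
  Pointwise-replicate r []       = []
  Pointwise-replicate r (q ∷ qs) = r q ∷ Pointwise-replicate r qs

  Pointwise-tabulate : ∀ {n} {f : Fin n → A} {xs : Vec B n} → (∀ i → R (f i) (Vec.lookup xs i)) → Pointwise R (Vec.tabulate f) xs
  Pointwise-tabulate {xs = xs} r = subst (Pointwise R _) (tabulate∘lookup xs) (tabulate⁺ r)

Pointwise-mapˡ : ∀ {A A′ B : Set} {R : A → B → Set} {S : A′ → B → Set} {f : A → A′} →
  (∀ {q x} → R q x → S (f q) x) → ∀ {n} {qs : Vec A n} {xs : Vec B n} → Pointwise R qs xs → Pointwise S (Vec.map f qs) xs
Pointwise-mapˡ R⇒S []       = []
Pointwise-mapˡ R⇒S (r ∷ rs) = R⇒S r ∷ Pointwise-mapˡ R⇒S rs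

Pointwise-zipWith : ∀ {A B C D : Set} {R : A → B → Set} {S : A → C → Set} {T : A → D → Set} {f : B → C → D} →
  (∀ {q x y} → R q x → S q y → T q (f x y)) →
  ∀ {n} {qs : Vec A n} {xs : Vec B n} {ys : Vec C n} → Pointwise R qs xs → Pointwise S qs ys → Pointwise T qs (Vec.zipWith f xs ys)
Pointwise-zipWith combine []       []       = []
Pointwise-zipWith combine (r ∷ rs) (s ∷ ss) = combine r s ∷ Pointwise-zipWith combine rs ss

record Frac (np : ℕ) : Set where
  constructor _⊖_÷1+_
  field
    pos neg : NatExpr np
    den-1   : ℕ

module _ {np : ℕ} where

  natF : NatExpr np → Frac np
  natF e = e ⊖ const 0 ÷1+ 0

  constF : ℚ → Frac np
  constF w = const (numerator⁺ w) ⊖ const (numerator⁻ w) ÷1+ ℚ.denominator-1 w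

  _+F_ : Frac np → Frac np → Frac np
  (P ⊖ M ÷1+ D) +F (P′ ⊖ M′ ÷1+ D′) =
    (P *ᴱ const (suc D′) +ᴱ P′ *ᴱ const (suc D)) ⊖ (M *ᴱ const (suc D′) +ᴱ M′ *ᴱ const (suc D)) ÷1+ (D ⊛ D′)

  _·F_ : ℚ → Frac np → Frac np
  w ·F (P ⊖ M ÷1+ D) = (a *ᴱ P +ᴱ b *ᴱ M) ⊖ (a *ᴱ M +ᴱ b *ᴱ P) ÷1+ (ℚ.denominator-1 w ⊛ D)
    where a = const (numerator⁺ w); b = const (numerator⁻ w)

  reluF : Frac np → Frac np
  reluF (P ⊖ M ÷1+ D) = (P ∸ᴱ M) ⊖ const 0 ÷1+ D

  neighbourSumF : Frac np → Frac np
  neighbourSumF (P ⊖ M ÷1+ D) = neighbourSum P ⊖ neighbourSum M ÷1+ D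

  dotF : ∀ {m} → Vec ℚ m → Vec (Frac np) m → Frac np
  dotF ws qs = Vec.foldr _ _+F_ (natF (const 0)) (Vec.zipWith _·F_ ws qs)

  compileFFN : ∀ {m l} → FFN m l → Vec (Frac np) m → Vec (Frac np) l
  compileFFN idN         qs = qs
  compileFFN (aff W b f) qs = compileFFN f (Vec.zipWith _+F_ (Vec.map (λ row → dotF row qs) W) (Vec.map constF b))
  compileFFN (relu f)    qs = compileFFN f (Vec.map reluF qs)

  compileGNN : ∀ {d} → GNN d → Vec (Frac np) d → Frac np
  compileGNN done        qs = Vec.head qs
  compileGNN (layer c g) qs = compileGNN g (compileFFN c (qs Vec.++ Vec.map neighbourSumF qs))

  -- The key of a node is its rank in the order.
  initialFracs : Vec (Frac np) (np ℕ.+ 1)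
  initialFracs = Vec.tabulate (natF ∘ label) Vec.++ (natF rank ∷ [])

  positivity : Frac np → Formula np 1 0
  positivity (P ⊖ M ÷1+ _) = leqT (oneT ⊕ term M Fin.zero) (term P Fin.zero)

module Semantics {np : ℕ} (G : Graph np) (O : LinOrder G) where
  open Sem G O

  rankOf : V → ℕ
  rankOf v = sum (map (λ y → fromBool (lt O y v)) (allFin (N G)))

  neighbours : V → List V
  neighbours v = filter (λ y → T? (adj G v y)) (allFin (N G))

  ⟦_⟧ : NatExpr np → V → ℕ
  ⟦ const n ⟧        v = n
  ⟦ size ⟧           v = N G
  ⟦ rank ⟧           v = rankOf v
  ⟦ label p ⟧        v = fromBool (Vec.lookup (lab G v) p)
  ⟦ e +ᴱ f ⟧         v = ⟦ e ⟧ v ℕ.+ ⟦ f ⟧ v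
  ⟦ e *ᴱ f ⟧         v = ⟦ e ⟧ v ℕ.* ⟦ f ⟧ v
  ⟦ e ∸ᴱ f ⟧         v = ⟦ e ⟧ v ∸ ⟦ f ⟧ v
  ⟦ neighbourSum e ⟧ v = sum (map ⟦ e ⟧ (neighbours v))

  numeral-correct : ∀ {a b} n (ρ : Vector V a) (σ : Vector ℕ b) → evalT (numeral n) ρ σ ≡ n
  numeral-correct zero    ρ σ = refl
  numeral-correct (suc n) ρ σ = cong suc (numeral-correct n ρ σ)

  length-allFin : length (allFin (N G)) ≡ N G
  length-allFin = length-tabulate (λ v → v)

  fromBool≤1 : ∀ c → fromBool c ℕ.≤ 1
  fromBool≤1 true  = ℕ.≤-refl
  fromBool≤1 false = z≤n

  ⟦⟧≤bound : ∀ {a b} e v (ρ : Vector V a) (σ : Vector ℕ b) → ⟦ e ⟧ v ℕ.≤ evalT (bound e) ρ σ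
  ⟦⟧≤bound (const n)        v ρ σ = ℕ.≤-reflexive (sym (numeral-correct n ρ σ))
  ⟦⟧≤bound size             v ρ σ = ℕ.≤-refl
  ⟦⟧≤bound rank             v ρ σ = subst (rankOf v ℕ.≤_)
    (trans (ℕ.*-identityʳ _) length-allFin)
    (sum-map-≤-length* _ (allFin (N G)) (λ y → fromBool≤1 (lt O y v)))
  ⟦⟧≤bound (label p)        v ρ σ = fromBool≤1 (Vec.lookup (lab G v) p)
  ⟦⟧≤bound (e +ᴱ f)         v ρ σ = ℕ.+-mono-≤ (⟦⟧≤bound e v ρ σ) (⟦⟧≤bound f v ρ σ)
  ⟦⟧≤bound (e *ᴱ f)         v ρ σ = ℕ.*-mono-≤ (⟦⟧≤bound e v ρ σ) (⟦⟧≤bound f v ρ σ)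
  ⟦⟧≤bound (e ∸ᴱ f)         v ρ σ = ℕ.≤-trans (ℕ.m∸n≤m (⟦ e ⟧ v) (⟦ f ⟧ v)) (⟦⟧≤bound e v ρ σ)
  ⟦⟧≤bound (neighbourSum e) v ρ σ = ℕ.≤-trans
    (sum-map-≤-length* ⟦ e ⟧ (neighbours v) (λ y → ⟦⟧≤bound e y ρ σ))
    (ℕ.*-monoˡ-≤ _ (subst (length (neighbours v) ℕ.≤_) length-allFin (length-filter _ (allFin (N G)))))

  term-correct : ∀ {a b} e (x : Fin a) (ρ : Vector V a) (σ : Vector ℕ b) →
    evalT (term e x) ρ σ ≡ ⟦ e ⟧ (ρ x)
  term-correct (const n)        x ρ σ = numeral-correct n ρ σ
  term-correct size             x ρ σ = refl
  term-correct rank             x ρ σ = refl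
  term-correct (label p)        x ρ σ = refl
  term-correct (e +ᴱ f)         x ρ σ = cong₂ ℕ._+_ (term-correct e x ρ σ) (term-correct f x ρ σ)
  term-correct (e *ᴱ f)         x ρ σ = cong₂ ℕ._*_ (term-correct e x ρ σ) (term-correct f x ρ σ)
  term-correct (e ∸ᴱ f)         x ρ σ = begin
    evalT (term (e ∸ᴱ f) x) ρ σ
      ≡⟨ sumBelow-cong (evalT (term e x) ρ σ) (λ i → cong (λ k → fromBool (k ≤ᵇ i)) (term-correct f x ρ _)) ⟩
    sumBelow (evalT (term e x) ρ σ) (λ i → fromBool (⟦ f ⟧ (ρ x) ≤ᵇ i))
      ≡⟨ count-≤ _ (⟦ f ⟧ (ρ x)) ⟩
    evalT (term e x) ρ σ ∸ ⟦ f ⟧ (ρ x)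
      ≡⟨ cong (_∸ ⟦ f ⟧ (ρ x)) (term-correct e x ρ σ) ⟩
    ⟦ e ⟧ (ρ x) ∸ ⟦ f ⟧ (ρ x) ∎
  term-correct (neighbourSum e) x ρ σ = begin
    evalT (term (neighbourSum e) x) ρ σ
      ≡⟨ cong sum (map-cong (λ y → sumBelow-cong B (λ i →
           cong (λ k → fromBool (adj G (ρ x) y ∧ (suc i ≤ᵇ k))) (term-correct e Fin.zero _ _))) (allFin (N G))) ⟩
    sum (map (λ y → sumBelow B (λ i → fromBool (adj G (ρ x) y ∧ (suc i ≤ᵇ ⟦ e ⟧ y)))) (allFin (N G)))
      ≡⟨ cong sum (map-cong neighbour-count (allFin (N G))) ⟩
    sum (map (λ y → if adj G (ρ x) y then ⟦ e ⟧ y else 0) (allFin (N G)))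
      ≡⟨ sum-map-if (adj G (ρ x)) ⟦ e ⟧ (allFin (N G)) ⟩
    ⟦ neighbourSum e ⟧ (ρ x) ∎
    where
    B = evalT (bound e) ρ σ
    neighbour-count : ∀ y → sumBelow B (λ i → fromBool (adj G (ρ x) y ∧ (suc i ≤ᵇ ⟦ e ⟧ y)))
                          ≡ (if adj G (ρ x) y then ⟦ e ⟧ y else 0)
    neighbour-count y = trans (sumBelow-∧ B (adj G (ρ x) y) (λ i → suc i ≤ᵇ ⟦ e ⟧ y))
      (cong (if adj G (ρ x) y then_else 0) (trans (count-< B (⟦ e ⟧ y)) (ℕ.m≥n⇒m⊓n≡n (⟦⟧≤bound e y ρ σ))))

  Represents : V → Frac np → ℚ → Set
  Represents v q x = Encodes (⟦ Frac.pos q ⟧ v) (⟦ Frac.neg q ⟧ v) (Frac.den-1 q) x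

  Represents* : V → ∀ {d} → Vec (Frac np) d → Vec ℚ d → Set
  Represents* v = Pointwise (Represents v)

  module _ {v : V} where

    represents-+ : ∀ {q q′ x y} → Represents v q x → Represents v q′ y → Represents v (q +F q′) (x + y)
    represents-+ = encodes-+

    represents-· : ∀ w {q x} → Represents v q x → Represents v (w ·F q) (w * x)
    represents-· w = encodes-* (encodes-ℚ w)

    represents-dot : ∀ {m} (ws : Vec ℚ m) {qs xs} → Represents* v qs xs → Represents v (dotF ws qs) (dot ws xs)
    represents-dot []       []       = encodes-0 0
    represents-dot (w ∷ ws) {q ∷ qs} (r ∷ rs) =
      represents-+ {w ·F q} {dotF ws qs} (represents-· w {q} r) (represents-dot ws rs)

    represents-affine : ∀ {m k} (W : Vec (Vec ℚ m) k) (b : Vec ℚ k) {qs xs} → Represents* v qs xs →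
      Represents* v (Vec.zipWith _+F_ (Vec.map (λ row → dotF row qs) W) (Vec.map constF b))
                    (Vec.zipWith _+_ (Vec.map (λ row → dot row xs) W) b)
    represents-affine []        []      rs = []
    represents-affine (row ∷ W) (c ∷ b) {qs} rs =
      represents-+ {dotF row qs} {constF c} (represents-dot row rs) (encodes-ℚ c) ∷ represents-affine W b rs

    represents-FFN : ∀ {m l} (f : FFN m l) {qs xs} → Represents* v qs xs →
      Represents* v (compileFFN f qs) (evalFFN f xs)
    represents-FFN idN         rs = rs
    represents-FFN (aff W b f) rs = represents-FFN f (represents-affine W b rs)
    represents-FFN (relu f)    rs = represents-FFN f (map⁺ encodes-ReLU rs)

  represents-aggSum : ∀ {d} {qs : Vec (Frac np) d} (emb : V → Vec ℚ d) →
    (∀ y → Represents* y qs (emb y)) → ∀ v → Represents* v (Vec.map neighbourSumF qs) (aggSum G emb v)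
  represents-aggSum {qs = qs} emb rs v = Pointwise-mapˡ (λ r → r) (represents-vsum (neighbours v))
    where
    -- Represents v (neighbourSumF q) unfolds to RepresentsSum (neighbours v) q.
    RepresentsSum : List V → Frac np → ℚ → Set
    RepresentsSum ys q x = Encodes (sum (map ⟦ Frac.pos q ⟧ ys)) (sum (map ⟦ Frac.neg q ⟧ ys)) (Frac.den-1 q) x
    represents-vsum : ∀ ys → Pointwise (RepresentsSum ys) qs (vsum (map emb ys))
    represents-vsum []       = Pointwise-replicate (encodes-0 ∘ Frac.den-1) qs
    represents-vsum (y ∷ ys) = Pointwise-zipWith encodes-+-sameDen (rs y) (represents-vsum ys)

  represents-GNN : ∀ {d} (g : GNN d) {qs} (emb : V → Vec ℚ d) → (∀ y → Represents* y qs (emb y)) →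
    ∀ u → Represents u (compileGNN g qs) (Vec.head (runGNN G g emb u))
  represents-GNN done        emb rs u = Pointwise-head (rs u)
  represents-GNN (layer c g) emb rs u = represents-GNN g _
    (λ y → represents-FFN c (++⁺ (rs y) (represents-aggSum emb rs y))) u

  rankOf-< : ∀ {v w} → lt O v w ≡ true → rankOf v ℕ.< rankOf w
  rankOf-< {v} {w} v<w = sum-map-mono-< below-v⇒below-w (∈-allFin v) v-separates
    where
    below-v⇒below-w : ∀ y → fromBool (lt O y v) ℕ.≤ fromBool (lt O y w)
    below-v⇒below-w y with lt O y v in y<v
    ... | false = z≤n
    ... | true rewrite LinOrder.trans O y v w y<v v<w = ℕ.≤-refl
    v-separates : fromBool (lt O v v) ℕ.< fromBool (lt O v w)
    v-separates rewrite LinOrder.irrefl O v | v<w = ℕ.0<1+n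

  rankOf-injective : ∀ {v w} → rankOf v ≡ rankOf w → v ≡ w
  rankOf-injective {v} {w} eq with v Fin.≟ w
  ... | yes v≡w = v≡w
  ... | no v≢w with LinOrder.total O v w v≢w
  ...   | inj₁ v<w = ⊥-elim (ℕ.<-irrefl eq (rankOf-< v<w))
  ...   | inj₂ w<v = ⊥-elim (ℕ.<-irrefl (sym eq) (rankOf-< w<v))

  rankKey : Key G
  rankKey = ι ∘ rankOf , rankOf-injective ∘ ι-injective

  represents-initial : ∀ v → Represents* v initialFracs (initEmb' G (ι ∘ rankOf) v)
  represents-initial v = ++⁺ (Pointwise-tabulate label-bit) (encodes-ι (rankOf v) ∷ [])
    where
    label-bit : ∀ p → Represents v (natF (label p)) (Vec.lookup (Vec.map bit (lab G v)) p)
    label-bit p rewrite lookup-map p bit (lab G v) = encodes-bit (Vec.lookup (lab G v) p)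

  sat-positivity⇔ : ∀ q u → (Sat G O (positivity q) u ≡ true) ⇔ ⟦ Frac.neg q ⟧ u ℕ.< ⟦ Frac.pos q ⟧ u
  sat-positivity⇔ q u = subst (λ b → (b ≡ true) ⇔ ⟦ Frac.neg q ⟧ u ℕ.< ⟦ Frac.pos q ⟧ u)
    (sym (cong₂ (λ m p → suc m ≤ᵇ p) (term-correct (Frac.neg q) Fin.zero ρ VF.[]) (term-correct (Frac.pos q) Fin.zero ρ VF.[])))
    (≤ᵇ≡true⇔≤ (suc (⟦ Frac.neg q ⟧ u)) (⟦ Frac.pos q ⟧ u))
    where ρ = u VF.∷ VF.[]

  accepts-rankKey⇔sat : ∀ (𝒜 : GNN (np ℕ.+ 1)) u →
    Accepts 𝒜 G u rankKey ⇔ (Sat G O (positivity (compileGNN 𝒜 initialFracs)) u ≡ true)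
  accepts-rankKey⇔sat 𝒜 u = ⇔.trans
    (encodes-positive⇔ (represents-GNN 𝒜 (initEmb' G (ι ∘ rankOf)) represents-initial u))
    (⇔.sym (sat-positivity⇔ (compileGNN 𝒜 initialFracs) u))

≡true-⇔⇒≡ : ∀ {a b : Bool} → (a ≡ true ⇔ b ≡ true) → a ≡ b
≡true-⇔⇒≡ {true}  a⇔b = sym (Equivalence.to a⇔b refl)
≡true-⇔⇒≡ {false} {true}  a⇔b = Equivalence.from a⇔b refl
≡true-⇔⇒≡ {false} {false} a⇔b = refl

accepts⇔accepts-all : ∀ {np} (𝒜 : GNN (np ℕ.+ 1)) → KeyInvariant 𝒜 →
  ∀ G u (k : Key G) → Accepts 𝒜 G u k ⇔ (∀ k′ → Accepts 𝒜 G u k′)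
accepts⇔accepts-all 𝒜 invariant G u k = mk⇔ (λ acc k′ → Equivalence.to (invariant G u k k′) acc) (λ acc-all → acc-all k)

theorem5p9 : (np : ℕ) (Q : NodeQuery np) → IsoClosed Q →
  (𝒜 : GNN (np ℕ.+ 1)) → KeyInvariant 𝒜 → Expresses 𝒜 Q →
  InOrdInvFOC Q
theorem5p9 np Q _ 𝒜 invariant expresses = φ , order-invariant , defines
  where
  φ = positivity (compileGNN 𝒜 initialFracs)
  sat⇔accepted : ∀ G O u → (Sat G O φ u ≡ true) ⇔ (∀ k → Accepts 𝒜 G u k)
  sat⇔accepted G O u = ⇔.trans (⇔.sym (Semantics.accepts-rankKey⇔sat G O 𝒜 u))
                               (accepts⇔accepts-all 𝒜 invariant G u (Semantics.rankKey G O))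
  order-invariant : OrderInvariant φ
  order-invariant G O O′ u = ≡true-⇔⇒≡ (⇔.trans (sat⇔accepted G O u) (⇔.sym (sat⇔accepted G O′ u)))
  defines : DefinesQuery φ Q
  defines G O u = ⇔.trans (expresses G u) (⇔.sym (sat⇔accepted G O u))
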